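{- Let $x,y$ be nonzero complex numbers. Then for every integer $n\geq 0$, $$\left(\frac{1}{x}+\frac{1}{y}\right)\mathfrak{F}_{n+1}(x,y)=\sum_{k=0}^{n}\binom{n}{k}y^{n-k}\left(\mathfrak{F}_{k}(x,y)+\frac{1}{y}\mathfrak{F}_{k+1}(x,y)\right).$$
   Context: The generalized Fubini polynomials $\mathfrak{F}_n(x,y)$ are defined by $\sum_{n\geq0}\mathfrak{F}_n(x,y)\frac{t^n}{n!}=\frac{1}{1-\frac{x}{y}(e^{ty}-1)}$; equivalently $\mathfrak{F}_n(x,y)=\sum_{k=0}^n{n\brace k}k!x^ky^{n-k}$ with ${n\brace k}$ the Stirling numbers of the second kind. -}

module Defs where

open import Level using (Level)
open import Data.Nat using (ℕ; zero; suc; _!; _∸_) renaming (_+_ to _+ℕ_; _*_ to _*ℕ_)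
open import Algebra.Bundles using (CommutativeRing; Semiring)

stirling2 : ℕ → ℕ → ℕ
stirling2 zero    zero    = 1
stirling2 zero    (suc k) = 0
stirling2 (suc n) zero    = 0
stirling2 (suc n) (suc k) = suc k *ℕ stirling2 n (suc k) +ℕ stirling2 n k

module FubiniDefs {c ℓ : Level} (R : CommutativeRing c ℓ) where
  open CommutativeRing R
  open import Algebra.Definitions.RawSemiring (Semiring.rawSemiring semiring) public using (_×_; _^_)

  sumTo : ℕ → (ℕ → Carrier) → Carrier
  sumTo zero    f = f 0
  sumTo (suc n) f = sumTo n f + f (suc n)

  fubini : ℕ → Carrier → Carrier → Carrier
  fubini n x y = sumTo n (λ k → ((stirling2 n k *ℕ (k !)) × (x ^ k)) * (y ^ (n ∸ k)))

{-# OPTIONS --safe #-}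
module Submission where

-- Write 𝔉ₙ(x,y) = Σⱼ a(n,j) xʲ yⁿ⁻ʲ with a(n,j) = S(n,j) j!. Multiplied by xy, the identity
-- becomes the inverse-free identity
--   (x + y) 𝔉ₙ₊₁ = x Σₖ C(n,k) yⁿ⁻ᵏ (y 𝔉ₖ + 𝔉ₖ₊₁)
-- between binary forms of degree n+2. Comparing the coefficients of xʲ⁺¹ yⁿ⁺¹⁻ʲ reduces it to
--   Σₖ C(n,k) (a(k,j) + a(k+1,j)) = a(n+1,j) + a(n+1,j+1),
-- which follows from Σᵢ C(n,i) S(i,j) = S(n+1,j+1) and the recurrence of the Stirling numbers.

open import Defs
open import Level using (Level)
open import Data.Nat as ℕ using (ℕ; zero; suc; _∸_; _≤_; _<_; z≤n; s≤s; _!)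
import Data.Nat.Properties as ℕₚ
open import Data.Nat.Combinatorics using (_C_; k>n⇒nCk≡0; nCk+nC[k+1]≡[n+1]C[k+1])
open import Algebra.Bundles using (CommutativeRing; CommutativeSemiring)
open import Relation.Binary.PropositionalEquality as ≡ using (_≡_)
open import Function using (_∘_)

module PrefixSum {c ℓ} (CS : CommutativeSemiring c ℓ) where
  open CommutativeSemiring CS
  open import Algebra.Properties.CommutativeSemigroup +-commutativeSemigroup using (interchange)
  open import Algebra.Properties.CommutativeMonoid.Mult +-commutativeMonoid using (_×_; ×-distrib-+)

  -- The recursion of FubiniDefs.sumTo over an arbitrary commutative semiring, so that it also
  -- serves for the ℕ-valued coefficient identities.
  ∑≤ : ℕ → (ℕ → Carrier) → Carrier
  ∑≤ zero    f = f 0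
  ∑≤ (suc n) f = ∑≤ n f + f (suc n)

  syntax ∑≤ n (λ k → e) = ∑[ k ≤ n ] e

  ∑-cong : ∀ n {f g} → (∀ k → k ≤ n → f k ≈ g k) → ∑≤ n f ≈ ∑≤ n g
  ∑-cong zero    f≈g = f≈g 0 z≤n
  ∑-cong (suc n) f≈g =
    +-cong (∑-cong n (λ k k≤n → f≈g k (ℕₚ.m≤n⇒m≤1+n k≤n)))
           (f≈g (suc n) ℕₚ.≤-refl)

  ∑-suc : ∀ n f → ∑≤ (suc n) f ≈ f 0 + ∑[ k ≤ n ] f (suc k)
  ∑-suc zero    f = refl
  ∑-suc (suc n) f = trans (+-congʳ (∑-suc n f)) (+-assoc _ _ _)

  ∑-distrib-+ : ∀ n f g → ∑[ k ≤ n ] (f k + g k) ≈ ∑≤ n f + ∑≤ n g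
  ∑-distrib-+ zero    f g = refl
  ∑-distrib-+ (suc n) f g =
    trans (+-congʳ (∑-distrib-+ n f g)) (interchange _ _ _ _)

  *-distribˡ-∑ : ∀ n u f → u * ∑≤ n f ≈ ∑[ k ≤ n ] (u * f k)
  *-distribˡ-∑ zero    u f = refl
  *-distribˡ-∑ (suc n) u f = trans (distribˡ u _ _) (+-congʳ (*-distribˡ-∑ n u f))

  *-distribʳ-∑ : ∀ n u f → ∑≤ n f * u ≈ ∑[ k ≤ n ] (f k * u)
  *-distribʳ-∑ n u f =
    trans (*-comm _ u) (trans (*-distribˡ-∑ n u f) (∑-cong n (λ k _ → *-comm u (f k))))

  ×-distrib-∑ : ∀ m n f → m × ∑≤ n f ≈ ∑[ k ≤ n ] (m × f k)
  ×-distrib-∑ m zero    f = refl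
  ×-distrib-∑ m (suc n) f = trans (×-distrib-+ _ _ m) (+-congʳ (×-distrib-∑ m n f))

  ∑-comm : ∀ m n (f : ℕ → ℕ → Carrier) →
           ∑[ i ≤ m ] ∑[ j ≤ n ] f i j ≈ ∑[ j ≤ n ] ∑[ i ≤ m ] f i j
  ∑-comm zero    n f = refl
  ∑-comm (suc m) n f = trans (+-congʳ (∑-comm m n f)) (sym (∑-distrib-+ n _ _))

VanishesAbove : ℕ → (ℕ → ℕ) → Set
VanishesAbove d c = ∀ {j} → d < j → c j ≡ 0

shift : (ℕ → ℕ) → ℕ → ℕ
shift c zero    = 0
shift c (suc j) = c j

fubiniCoeff : ℕ → ℕ → ℕ
fubiniCoeff n k = stirling2 n k ℕ.* k !

termCoeff : ℕ → ℕ → ℕ → ℕ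
termCoeff n k j = (n C k) ℕ.* (fubiniCoeff k j ℕ.+ fubiniCoeff (suc k) j)

private module ℕ∑ = PrefixSum ℕₚ.+-*-commutativeSemiring

module StirlingNumbers where
  open import Data.Nat using (_+_; _*_)
  open ℕ∑
  open ≡.≡-Reasoning
  open import Data.Nat.Tactic.RingSolver using (solve-∀)
  open import Algebra.Properties.CommutativeSemigroup ℕₚ.+-commutativeSemigroup
    using (x∙yz≈y∙xz)

  S : ℕ → ℕ → ℕ
  S = stirling2

  stirling2-vanishes : ∀ n → VanishesAbove n (stirling2 n)
  stirling2-vanishes zero    {suc j} _         = ≡.refl
  stirling2-vanishes (suc n) {suc j} (s≤s n<j)
    rewrite stirling2-vanishes n (ℕₚ.m<n⇒m<1+n n<j) | stirling2-vanishes n n<j =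
      ≡.trans (ℕₚ.+-identityʳ _) (ℕₚ.*-zeroʳ j)

  fubiniCoeff-vanishes : ∀ n → VanishesAbove n (fubiniCoeff n)
  fubiniCoeff-vanishes n {j} n<j = ≡.cong (_* j !) (stirling2-vanishes n n<j)

  ∑-zero : ∀ n → ∑[ k ≤ n ] 0 ≡ 0
  ∑-zero zero    = ≡.refl
  ∑-zero (suc n) = ≡.trans (ℕₚ.+-identityʳ _) (∑-zero n)

  mutual
    ∑-binomial-stirling2 : ∀ n j → ∑[ i ≤ n ] ((n C i) * S i j) ≡ S (suc n) (suc j)
    ∑-binomial-stirling2 zero    j =
      ≡.trans (ℕₚ.+-identityʳ (S 0 j)) (≡.cong (_+ S 0 j) (≡.sym (ℕₚ.*-zeroʳ j)))
    ∑-binomial-stirling2 (suc n) j = begin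
      ∑[ i ≤ suc n ] ((suc n C i) * S i j)
        ≡⟨ ∑-suc n _ ⟩
      (suc n C 0) * S 0 j + ∑[ i ≤ n ] ((suc n C suc i) * S (suc i) j)
        ≡⟨ ≡.cong ((suc n C 0) * S 0 j +_) (∑-cong n λ i _ →
             ≡.trans (≡.cong (_* S (suc i) j) (≡.sym (nCk+nC[k+1]≡[n+1]C[k+1] n i)))
                     (ℕₚ.*-distribʳ-+ (S (suc i) j) (n C i) _)) ⟩
      (suc n C 0) * S 0 j + ∑[ i ≤ n ] ((n C i) * S (suc i) j + (n C suc i) * S (suc i) j)
        ≡⟨ ≡.cong ((suc n C 0) * S 0 j +_) (∑-distrib-+ n _ _) ⟩
      (suc n C 0) * S 0 j + (A + B)
        -- both suc n C 0 and n C 0 compute to 1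
        ≡⟨ x∙yz≈y∙xz _ A B ⟩
      A + ((n C 0) * S 0 j + B)
        ≡⟨ ≡.cong₂ _+_ (∑-binomial-stirling2-suc n j)
                       (≡.sym (∑-suc n (λ i → (n C i) * S i j))) ⟩
      j * S (suc n) (suc j) + S (suc n) j + ∑[ i ≤ suc n ] ((n C i) * S i j)
        ≡⟨ ≡.cong (j * S (suc n) (suc j) + S (suc n) j +_) dropLast ⟩
      j * S (suc n) (suc j) + S (suc n) j + ∑[ i ≤ n ] ((n C i) * S i j)
        ≡⟨ ≡.cong (j * S (suc n) (suc j) + S (suc n) j +_) (∑-binomial-stirling2 n j) ⟩
      j * S (suc n) (suc j) + S (suc n) j + S (suc n) (suc j)
        ≡⟨ j*a+b+a≡[1+j]*a+b j _ _ ⟩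
      suc j * S (suc n) (suc j) + S (suc n) j ∎
      where
      j*a+b+a≡[1+j]*a+b : ∀ j a b → j * a + b + a ≡ suc j * a + b
      j*a+b+a≡[1+j]*a+b = solve-∀
      A B : ℕ
      A = ∑[ i ≤ n ] ((n C i) * S (suc i) j)
      B = ∑[ i ≤ n ] ((n C suc i) * S (suc i) j)
      dropLast : ∑[ i ≤ suc n ] ((n C i) * S i j) ≡ ∑[ i ≤ n ] ((n C i) * S i j)
      dropLast rewrite k>n⇒nCk≡0 (ℕₚ.n<1+n n) = ℕₚ.+-identityʳ _

    ∑-binomial-stirling2-suc : ∀ n j →
      ∑[ i ≤ n ] ((n C i) * S (suc i) j) ≡ j * S (suc n) (suc j) + S (suc n) j
    ∑-binomial-stirling2-suc n zero =
      ≡.trans (∑-cong n (λ i _ → ℕₚ.*-zeroʳ (n C i))) (∑-zero n)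
    ∑-binomial-stirling2-suc n (suc j) = begin
      ∑[ i ≤ n ] ((n C i) * S (suc i) (suc j))
        ≡⟨ ∑-cong n (λ i _ → c*[[1+j]*a+b]≡[1+j]*[c*a]+c*b (n C i) j _ _) ⟩
      ∑[ i ≤ n ] (suc j * ((n C i) * S i (suc j)) + (n C i) * S i j)
        ≡⟨ ∑-distrib-+ n _ _ ⟩
      ∑[ i ≤ n ] (suc j * ((n C i) * S i (suc j))) + ∑[ i ≤ n ] ((n C i) * S i j)
        ≡⟨ ≡.cong₂ _+_ (≡.sym (*-distribˡ-∑ n (suc j) _)) ≡.refl ⟩
      suc j * ∑[ i ≤ n ] ((n C i) * S i (suc j)) + ∑[ i ≤ n ] ((n C i) * S i j)
        ≡⟨ ≡.cong₂ _+_ (≡.cong (suc j *_) (∑-binomial-stirling2 n (suc j)))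
                       (∑-binomial-stirling2 n j) ⟩
      suc j * S (suc n) (suc (suc j)) + S (suc n) (suc j) ∎
      where
      c*[[1+j]*a+b]≡[1+j]*[c*a]+c*b : ∀ c j a b → c * (suc j * a + b) ≡ suc j * (c * a) + c * b
      c*[[1+j]*a+b]≡[1+j]*[c*a]+c*b = solve-∀

  ∑-binomial-fubiniCoeff : ∀ n j →
    ∑[ k ≤ n ] ((n C k) * (fubiniCoeff k j + fubiniCoeff (suc k) j))
      ≡ fubiniCoeff (suc n) j + fubiniCoeff (suc n) (suc j)
  ∑-binomial-fubiniCoeff n j = begin
    ∑[ k ≤ n ] ((n C k) * (S k j * j ! + S (suc k) j * j !))
      ≡⟨ ∑-cong n (λ k _ → c*[a*f+b*f]≡f*[c*a]+f*[c*b] (n C k) _ _ (j !)) ⟩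
    ∑[ k ≤ n ] (j ! * ((n C k) * S k j) + j ! * ((n C k) * S (suc k) j))
      ≡⟨ ∑-distrib-+ n _ _ ⟩
    ∑[ k ≤ n ] (j ! * ((n C k) * S k j)) + ∑[ k ≤ n ] (j ! * ((n C k) * S (suc k) j))
      ≡⟨ ≡.cong₂ _+_ (*-distribˡ-∑ n (j !) _) (*-distribˡ-∑ n (j !) _) ⟨
    j ! * ∑[ k ≤ n ] ((n C k) * S k j) + j ! * ∑[ k ≤ n ] ((n C k) * S (suc k) j)
      ≡⟨ ≡.cong₂ (λ a b → j ! * a + j ! * b)
                 (∑-binomial-stirling2 n j) (∑-binomial-stirling2-suc n j) ⟩
    j ! * S (suc n) (suc j) + j ! * (j * S (suc n) (suc j) + S (suc n) j)
      ≡⟨ f*a+f*[j*a+b]≡b*f+a*[[1+j]*f] (j !) j _ _ ⟩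
    S (suc n) j * j ! + S (suc n) (suc j) * (suc j * j !) ∎
    where
    c*[a*f+b*f]≡f*[c*a]+f*[c*b] : ∀ c a b f → c * (a * f + b * f) ≡ f * (c * a) + f * (c * b)
    c*[a*f+b*f]≡f*[c*a]+f*[c*b] = solve-∀
    f*a+f*[j*a+b]≡b*f+a*[[1+j]*f] : ∀ f j a b → f * a + f * (j * a + b) ≡ b * f + a * (suc j * f)
    f*a+f*[j*a+b]≡b*f+a*[[1+j]*f] = solve-∀

open StirlingNumbers using (fubiniCoeff-vanishes; ∑-binomial-fubiniCoeff)

module BinaryForms {c ℓ} (R : CommutativeRing c ℓ) where
  open CommutativeRing R
  open FubiniDefs R
  open PrefixSum commutativeSemiring
  open import Algebra.Properties.Semiring.Mult semiring
    using (×-congˡ; ×-congʳ; ×-homo-0; ×-homo-+; ×-assoc-*; ×-comm-*; ×-assocˡ)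
  open import Algebra.Properties.Semiring.Exp semiring using (^-congʳ)
  open import Algebra.Properties.CommutativeSemigroup *-commutativeSemigroup using (x∙yz≈y∙xz)
  open import Relation.Binary.Reasoning.Setoid setoid

  sumTo≡∑ : ∀ n f → sumTo n f ≡ ∑≤ n f
  sumTo≡∑ zero    f = ≡.refl
  sumTo≡∑ (suc n) f = ≡.cong (_+ f (suc n)) (sumTo≡∑ n f)

  ×-homo-∑ : ∀ n g u → ℕ∑.∑≤ n g × u ≈ ∑[ k ≤ n ] (g k × u)
  ×-homo-∑ zero    g u = refl
  ×-homo-∑ (suc n) g u =
    trans (×-homo-+ u (ℕ∑.∑≤ n g) (g (suc n))) (+-congʳ (×-homo-∑ n g u))

  module _ (x y : Carrier) where

    form : ℕ → (ℕ → ℕ) → Carrier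
    form d c = ∑[ j ≤ d ] ((c j × x ^ j) * y ^ (d ∸ j))

    form-cong : ∀ d {c c′} → (∀ j → c j ≡ c′ j) → form d c ≈ form d c′
    form-cong d c≡c′ = ∑-cong d (λ j _ → *-congʳ (×-congˡ (c≡c′ j)))

    form-+ : ∀ d c c′ → form d c + form d c′ ≈ form d (λ j → c j ℕ.+ c′ j)
    form-+ d c c′ = trans (sym (∑-distrib-+ d _ _)) (∑-cong d (λ j _ →
      trans (sym (distribʳ _ _ _)) (*-congʳ (sym (×-homo-+ (x ^ j) (c j) (c′ j))))))

    form-× : ∀ m d c → m × form d c ≈ form d (λ j → m ℕ.* c j)
    form-× m d c = trans (×-distrib-∑ m d _) (∑-cong d (λ j _ →
      trans (sym (×-assoc-* m _ _)) (*-congʳ (×-assocˡ (x ^ j) m (c j)))))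

    form-∑ : ∀ n d (g : ℕ → ℕ → ℕ) →
             ∑[ k ≤ n ] form d (g k) ≈ form d (λ j → ℕ∑.∑≤ n (λ k → g k j))
    form-∑ n d g = trans (∑-comm n d _) (∑-cong d (λ j _ →
      trans (sym (*-distribʳ-∑ n _ _)) (*-congʳ (sym (×-homo-∑ n (λ k → g k j) (x ^ j))))))

    x-*-form : ∀ d c → x * form d c ≈ form (suc d) (shift c)
    x-*-form d c = begin
      x * form d c
        ≈⟨ *-distribˡ-∑ d x _ ⟩
      ∑[ j ≤ d ] (x * ((c j × x ^ j) * y ^ (d ∸ j)))
        ≈⟨ ∑-cong d (λ j _ →
             trans (sym (*-assoc _ _ _)) (*-congʳ (×-comm-* (c j) x (x ^ j)))) ⟩
      ∑[ j ≤ d ] ((c j × x ^ suc j) * y ^ (d ∸ j))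
        ≈⟨ sym (+-identityˡ _) ⟩
      0# + ∑[ j ≤ d ] ((c j × x ^ suc j) * y ^ (d ∸ j))
        ≈⟨ +-congʳ (sym (zeroˡ _)) ⟩
      (shift c 0 × x ^ 0) * y ^ (suc d ∸ 0)
        + ∑[ j ≤ d ] ((shift c (suc j) × x ^ suc j) * y ^ (suc d ∸ suc j))
        ≈⟨ sym (∑-suc d _) ⟩
      form (suc d) (shift c) ∎

    y-*-form : ∀ d {c} → VanishesAbove d c → y * form d c ≈ form (suc d) c
    y-*-form d {c} vanishes = begin
      y * form d c
        ≈⟨ *-distribˡ-∑ d y _ ⟩
      ∑[ j ≤ d ] (y * ((c j × x ^ j) * y ^ (d ∸ j)))
        ≈⟨ ∑-cong d (λ j j≤d → trans (x∙yz≈y∙xz y _ _)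
             (*-congˡ (^-congʳ y (≡.sym (ℕₚ.+-∸-assoc 1 j≤d))))) ⟩
      ∑[ j ≤ d ] ((c j × x ^ j) * y ^ (suc d ∸ j))
        ≈⟨ sym (+-identityʳ _) ⟩
      ∑[ j ≤ d ] ((c j × x ^ j) * y ^ (suc d ∸ j)) + 0#
        ≈⟨ +-congˡ (sym topTerm≈0) ⟩
      form (suc d) c ∎
      where
      topTerm≈0 : (c (suc d) × x ^ suc d) * y ^ (d ∸ d) ≈ 0#
      topTerm≈0 = trans (*-congʳ (trans (×-congˡ (vanishes (ℕₚ.n<1+n d)))
                                        (×-homo-0 (x ^ suc d))))
                        (zeroˡ (y ^ (d ∸ d)))

    y^-*-form : ∀ e d {c} → VanishesAbove d c → y ^ e * form d c ≈ form (e ℕ.+ d) c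
    y^-*-form zero    d vanishes = *-identityˡ _
    y^-*-form (suc e) d {c} vanishes = begin
      (y * y ^ e) * form d c   ≈⟨ *-assoc _ _ _ ⟩
      y * (y ^ e * form d c)   ≈⟨ *-congˡ (y^-*-form e d vanishes) ⟩
      y * form (e ℕ.+ d) c     ≈⟨ y-*-form (e ℕ.+ d) (vanishes ∘ ℕₚ.≤-<-trans (ℕₚ.m≤n+m d e)) ⟩
      form (suc e ℕ.+ d) c     ∎

    fubini≡form : ∀ n → fubini n x y ≡ form n (fubiniCoeff n)
    fubini≡form n = sumTo≡∑ n _

    y-*-fubini : ∀ n → y * fubini n x y ≈ form (suc n) (fubiniCoeff n)
    y-*-fubini n = trans (*-congˡ (reflexive (fubini≡form n))) (y-*-form n (fubiniCoeff-vanishes n))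

    recurrence-term≈form : ∀ n k → k ≤ n →
      ((n C k) × y ^ (n ∸ k)) * (y * fubini k x y + fubini (suc k) x y)
        ≈ form (suc n) (termCoeff n k)
    recurrence-term≈form n k k≤n = begin
      ((n C k) × y ^ (n ∸ k)) * (y * fubini k x y + fubini (suc k) x y)
        ≈⟨ ×-assoc-* (n C k) _ _ ⟩
      (n C k) × (y ^ (n ∸ k) * (y * fubini k x y + fubini (suc k) x y))
        ≈⟨ ×-congʳ (n C k) (distribˡ _ _ _) ⟩
      (n C k) × (y ^ (n ∸ k) * (y * fubini k x y) + y ^ (n ∸ k) * fubini (suc k) x y)
        ≈⟨ ×-congʳ (n C k) (+-cong (*-congˡ (y-*-fubini k))
                                     (*-congˡ (reflexive (fubini≡form (suc k))))) ⟩
      (n C k) × (y ^ (n ∸ k) * form (suc k) (fubiniCoeff k)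
                   + y ^ (n ∸ k) * form (suc k) (fubiniCoeff (suc k)))
        ≈⟨ ×-congʳ (n C k) (+-cong (raise (λ lt → fubiniCoeff-vanishes k (ℕₚ.<⇒≤ lt)))
                                     (raise (fubiniCoeff-vanishes (suc k)))) ⟩
      (n C k) × (form (suc n) (fubiniCoeff k) + form (suc n) (fubiniCoeff (suc k)))
        ≈⟨ ×-congʳ (n C k) (form-+ (suc n) (fubiniCoeff k) (fubiniCoeff (suc k))) ⟩
      (n C k) × form (suc n) (λ j → fubiniCoeff k j ℕ.+ fubiniCoeff (suc k) j)
        ≈⟨ form-× (n C k) (suc n) _ ⟩
      form (suc n) (termCoeff n k) ∎
      where
      degree : n ∸ k ℕ.+ suc k ≡ suc n
      degree = ≡.trans (ℕₚ.+-suc (n ∸ k) k) (≡.cong suc (ℕₚ.m∸n+n≡m k≤n))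
      raise : ∀ {c} → VanishesAbove (suc k) c → y ^ (n ∸ k) * form (suc k) c ≈ form (suc n) c
      raise {c} vanishes =
        trans (y^-*-form (n ∸ k) (suc k) vanishes) (reflexive (≡.cong (λ d → form d c) degree))

    fubini-recurrence : ∀ n →
      (x + y) * fubini (suc n) x y
        ≈ x * ∑[ k ≤ n ] (((n C k) × y ^ (n ∸ k)) * (y * fubini k x y + fubini (suc k) x y))
    fubini-recurrence n = begin
      (x + y) * fubini (suc n) x y
        ≈⟨ distribʳ _ _ _ ⟩
      x * fubini (suc n) x y + y * fubini (suc n) x y
        ≈⟨ +-cong (trans (*-congˡ (reflexive (fubini≡form (suc n)))) (x-*-form (suc n) b))
                  (y-*-fubini (suc n)) ⟩
      form (suc (suc n)) (shift b) + form (suc (suc n)) b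
        ≈⟨ form-+ (suc (suc n)) (shift b) b ⟩
      form (suc (suc n)) (λ j → shift b j ℕ.+ b j)
        ≈⟨ form-cong (suc (suc n)) shift-b+b≡shift[b+b∘suc] ⟩
      form (suc (suc n)) (shift (λ j → b j ℕ.+ b (suc j)))
        ≈⟨ sym (x-*-form (suc n) _) ⟩
      x * form (suc n) (λ j → b j ℕ.+ b (suc j))
        ≈⟨ *-congˡ (form-cong (suc n) (λ j → ≡.sym (∑-binomial-fubiniCoeff n j))) ⟩
      x * form (suc n) (λ j → ℕ∑.∑≤ n (λ k → termCoeff n k j))
        ≈⟨ *-congˡ (sym (form-∑ n (suc n) _)) ⟩
      x * ∑[ k ≤ n ] form (suc n) (termCoeff n k)
        ≈⟨ *-congˡ (∑-cong n (λ k k≤n → sym (recurrence-term≈form n k k≤n))) ⟩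
      x * ∑[ k ≤ n ] (((n C k) × y ^ (n ∸ k)) * (y * fubini k x y + fubini (suc k) x y)) ∎
      where
      b : ℕ → ℕ
      b = fubiniCoeff (suc n)
      shift-b+b≡shift[b+b∘suc] : ∀ j → shift b j ℕ.+ b j ≡ shift (λ i → b i ℕ.+ b (suc i)) j
      shift-b+b≡shift[b+b∘suc] zero    = ≡.refl   -- b 0 computes to 0
      shift-b+b≡shift[b+b∘suc] (suc j) = ≡.refl

module Inverses {c ℓ} (R : CommutativeRing c ℓ) where
  open CommutativeRing R
  open import Algebra.Solver.Ring.NaturalCoefficients.Default commutativeSemiring
  open import Relation.Binary.Reasoning.Setoid setoid

  module _ {x x⁻¹ : Carrier} (x*x⁻¹≈1 : x * x⁻¹ ≈ 1#) where

    x⁻¹*[x*u]≈u : ∀ u → x⁻¹ * (x * u) ≈ u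
    x⁻¹*[x*u]≈u u = begin
      x⁻¹ * (x * u)   ≈⟨ solve 3 (λ x a u → a :* (x :* u) := (x :* a) :* u) refl x x⁻¹ u ⟩
      (x * x⁻¹) * u   ≈⟨ *-congʳ x*x⁻¹≈1 ⟩
      1# * u          ≈⟨ *-identityˡ u ⟩
      u               ∎

    x⁻¹*[t*[x*a+b]]≈t*[a+x⁻¹*b] : ∀ t a b → x⁻¹ * (t * (x * a + b)) ≈ t * (a + x⁻¹ * b)
    x⁻¹*[t*[x*a+b]]≈t*[a+x⁻¹*b] t a b = begin
      x⁻¹ * (t * (x * a + b))
        ≈⟨ solve 5 (λ x x⁻¹ t a b → x⁻¹ :* (t :* (x :* a :+ b))
                                   := t :* (x⁻¹ :* (x :* a) :+ x⁻¹ :* b))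
             refl x x⁻¹ t a b ⟩
      t * (x⁻¹ * (x * a) + x⁻¹ * b)
        ≈⟨ *-congˡ (+-congʳ (x⁻¹*[x*u]≈u a)) ⟩
      t * (a + x⁻¹ * b) ∎

  x⁻¹+y⁻¹≈x⁻¹*y⁻¹*[x+y] : ∀ {x x⁻¹ y y⁻¹} → x * x⁻¹ ≈ 1# → y * y⁻¹ ≈ 1# →
                          x⁻¹ + y⁻¹ ≈ x⁻¹ * y⁻¹ * (x + y)
  x⁻¹+y⁻¹≈x⁻¹*y⁻¹*[x+y] {x} {x⁻¹} {y} {y⁻¹} x*x⁻¹≈1 y*y⁻¹≈1 = begin
    x⁻¹ + y⁻¹
      ≈⟨ +-cong (x⁻¹*[x*u]≈u y*y⁻¹≈1 x⁻¹) (x⁻¹*[x*u]≈u x*x⁻¹≈1 y⁻¹) ⟨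
    y⁻¹ * (y * x⁻¹) + x⁻¹ * (x * y⁻¹)
      ≈⟨ solve 4 (λ x x⁻¹ y y⁻¹ → y⁻¹ :* (y :* x⁻¹) :+ x⁻¹ :* (x :* y⁻¹)
                                  := x⁻¹ :* y⁻¹ :* (x :+ y))
           refl x x⁻¹ y y⁻¹ ⟩
    x⁻¹ * y⁻¹ * (x + y) ∎

mainTheorem7 : {c ℓ : Level} (R : CommutativeRing c ℓ) →
  let open CommutativeRing R
      open FubiniDefs R
  in (x y x⁻¹ y⁻¹ : Carrier) → x * x⁻¹ ≈ 1# → y * y⁻¹ ≈ 1# →
     (n : ℕ) →
     (x⁻¹ + y⁻¹) * fubini (suc n) x y
       ≈ sumTo n (λ k → ((n C k) × (y ^ (n ∸ k))) * (fubini k x y + y⁻¹ * fubini (suc k) x y))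
mainTheorem7 R x y x⁻¹ y⁻¹ x*x⁻¹≈1 y*y⁻¹≈1 n = begin
  (x⁻¹ + y⁻¹) * F (suc n)
    ≈⟨ *-congʳ (x⁻¹+y⁻¹≈x⁻¹*y⁻¹*[x+y] x*x⁻¹≈1 y*y⁻¹≈1) ⟩
  x⁻¹ * y⁻¹ * (x + y) * F (suc n)
    ≈⟨ trans (*-assoc _ _ _) (*-congʳ (*-comm x⁻¹ y⁻¹)) ⟩
  y⁻¹ * x⁻¹ * ((x + y) * F (suc n))
    ≈⟨ trans (*-congˡ (fubini-recurrence x y n)) (*-assoc _ _ _) ⟩
  y⁻¹ * (x⁻¹ * (x * ∑[ k ≤ n ] (t k * (y * F k + F (suc k)))))
    ≈⟨ *-congˡ (x⁻¹*[x*u]≈u x*x⁻¹≈1 _) ⟩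
  y⁻¹ * ∑[ k ≤ n ] (t k * (y * F k + F (suc k)))
    ≈⟨ *-distribˡ-∑ n y⁻¹ _ ⟩
  ∑[ k ≤ n ] (y⁻¹ * (t k * (y * F k + F (suc k))))
    ≈⟨ ∑-cong n (λ k _ → x⁻¹*[t*[x*a+b]]≈t*[a+x⁻¹*b] y*y⁻¹≈1 (t k) (F k) (F (suc k))) ⟩
  ∑[ k ≤ n ] (t k * (F k + y⁻¹ * F (suc k)))
    ≡⟨ sumTo≡∑ n _ ⟨
  sumTo n (λ k → t k * (F k + y⁻¹ * F (suc k))) ∎
  where
  open CommutativeRing R
  open FubiniDefs R
  open PrefixSum commutativeSemiring using (∑≤; ∑-cong; *-distribˡ-∑)
  open BinaryForms R using (sumTo≡∑; fubini-recurrence)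
  open Inverses R
  open import Relation.Binary.Reasoning.Setoid setoid

  F : ℕ → Carrier
  F k = fubini k x y

  t : ℕ → Carrier
  t k = (n C k) × y ^ (n ∸ k)
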